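{- Let $j,k$ be non-negative integers with $k\le j$, and let $m$ be a positive integer. Then $$\sum_{t=0}^{m}\binom{m}{t}(k+t)!\,S(j,k+t)=k!\sum_{t=0}^{m-1}(-1)^t s(m,m-t)\,S(j+m-t,k+m).$$
   Context: $S(n,k)$ denotes the Stirling numbers of the second kind ($S(0,0)=1$, $S(n,k)=S(n-1,k-1)+kS(n-1,k)$, and $S(n,k)=0$ if $k<0$ or $k>n$). $s(n,k)$ denotes the unsigned Stirling numbers of the first kind, determined by $s(0,0)=1$, $s(n,k)=0$ if $k<0$ or $k>n$ or ($n>0$, $k=0$), and $s(n,k)=s(n-1,k-1)+(n-1)s(n-1,k)$. -}

module Defs where

open import Data.Nat using (ℕ; zero; suc; _+_; _*_)
open import Data.Integer as ℤ using (ℤ; +_; -_)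

S₂ : ℕ → ℕ → ℕ
S₂ zero    zero    = 1
S₂ zero    (suc k) = 0
S₂ (suc n) zero    = 0
S₂ (suc n) (suc k) = S₂ n k + suc k * S₂ n (suc k)

s₁ : ℕ → ℕ → ℕ
s₁ zero    zero    = 1
s₁ zero    (suc k) = 0
s₁ (suc n) zero    = 0
s₁ (suc n) (suc k) = s₁ n k + n * s₁ n (suc k)

ΣZ : ℕ → (ℕ → ℤ) → ℤ
ΣZ zero    f = + 0
ΣZ (suc n) f = ΣZ n f ℤ.+ f n

sign : ℕ → ℤ
sign zero    = + 1
sign (suc t) = - sign t

-- Write T(m, K) = Σᵢ (-1)^(m-i) s(m,i) S(j+i, K): the falling factorial x(x-1)⋯(x-m+1)
-- expanded in powers, with xⁱ read as S(j+i, K).  The right side is k! T(m, k+m) summed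
-- backwards, its i = 0 term vanishing since s(m, 0) = 0 for m ≥ 1.  The left side equals
-- k! T(m, k+m) by induction on m: Pascal's rule splits its binomial sum for m+1 into those for
-- (m, k) and (m, k+1), while multiplying the falling factorial by x − m, together with
-- S(n+1, K+1) = S(n, K) + (K+1) S(n, K+1), gives T(m+1, K+1) = T(m, K) + (K+1−m) T(m, K+1).
module Submission where

open import Defs
open import Data.Nat as ℕ using (ℕ; zero; suc; _+_; _∸_; _≤_; _<_; s≤s; NonZero; _!)
open import Data.Nat.Combinatorics using (_C_; nCk+nC[k+1]≡[n+1]C[k+1]; k>n⇒nCk≡0)
import Data.Nat.Properties as ℕ
open import Data.Integer as ℤ using (ℤ; +_)
import Data.Integer.Properties as ℤ
open import Data.Integer.Solver using (module +-*-Solver)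
open import Function using (_∘_)
open import Relation.Binary.PropositionalEquality
  using (_≡_; refl; sym; trans; cong; cong₂; module ≡-Reasoning)
open import Relation.Nullary using (yes; no)

open +-*-Solver
open ≡-Reasoning

ΣZ-cong : ∀ n {f g : ℕ → ℤ} → (∀ i → i < n → f i ≡ g i) → ΣZ n f ≡ ΣZ n g
ΣZ-cong zero    f≡g = refl
ΣZ-cong (suc n) f≡g =
  cong₂ ℤ._+_ (ΣZ-cong n (λ i i<n → f≡g i (ℕ.m<n⇒m<1+n i<n))) (f≡g n ℕ.≤-refl)

ΣZ-distrib-+ : ∀ n (f g : ℕ → ℤ) → ΣZ n (λ i → f i ℤ.+ g i) ≡ ΣZ n f ℤ.+ ΣZ n g
ΣZ-distrib-+ zero    f g = refl
ΣZ-distrib-+ (suc n) f g rewrite ΣZ-distrib-+ n f g =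
  solve 4 (λ a b c d → (a :+ b) :+ (c :+ d) := (a :+ c) :+ (b :+ d)) refl
    (ΣZ n f) (ΣZ n g) (f n) (g n)

*-distribˡ-ΣZ : ∀ n c (f : ℕ → ℤ) → c ℤ.* ΣZ n f ≡ ΣZ n (λ i → c ℤ.* f i)
*-distribˡ-ΣZ zero    c f = ℤ.*-zeroʳ c
*-distribˡ-ΣZ (suc n) c f rewrite sym (*-distribˡ-ΣZ n c f) = ℤ.*-distribˡ-+ c (ΣZ n f) (f n)

ΣZ-head : ∀ n (f : ℕ → ℤ) → ΣZ (suc n) f ≡ f 0 ℤ.+ ΣZ n (f ∘ suc)
ΣZ-head zero    f = ℤ.+-comm (+ 0) (f 0)
ΣZ-head (suc n) f rewrite ΣZ-head n f = ℤ.+-assoc (f 0) _ _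

ΣZ-reverse : ∀ n (f : ℕ → ℤ) → ΣZ (suc n) f ≡ ΣZ (suc n) (λ i → f (n ∸ i))
ΣZ-reverse zero    f = refl
ΣZ-reverse (suc n) f = begin
  ΣZ (suc n) f ℤ.+ f (suc n)                       ≡⟨ cong (ℤ._+ f (suc n)) (ΣZ-reverse n f) ⟩
  ΣZ (suc n) (λ i → f (n ∸ i)) ℤ.+ f (suc n)       ≡⟨ ℤ.+-comm _ (f (suc n)) ⟩
  f (suc n) ℤ.+ ΣZ (suc n) (λ i → f (n ∸ i))       ≡⟨ ΣZ-head (suc n) (λ i → f (suc n ∸ i)) ⟨
  ΣZ (suc (suc n)) (λ i → f (suc n ∸ i))           ∎

i>m⇒s₁mi≡0 : ∀ {m i} → m < i → s₁ m i ≡ 0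
i>m⇒s₁mi≡0 {zero}  {suc i} _ = refl
i>m⇒s₁mi≡0 {suc m} {suc i} (s≤s m<i)
  rewrite i>m⇒s₁mi≡0 m<i | i>m⇒s₁mi≡0 (ℕ.m<n⇒m<1+n m<i) | ℕ.*-zeroʳ m = refl

m*s₁m0≡0 : ∀ m → m ℕ.* s₁ m 0 ≡ 0
m*s₁m0≡0 zero    = refl
m*s₁m0≡0 (suc m) = ℕ.*-zeroʳ (suc m)

sign-∸-suc : ∀ {m i} → i < m → sign (m ∸ i) ≡ ℤ.- sign (m ∸ suc i)
sign-∸-suc {suc m} {zero}  _         = refl
sign-∸-suc {suc m} {suc i} (s≤s i<m) = sign-∸-suc i<m

-- Signed Stirling numbers of the first kind: x(x-1)⋯(x-m+1) = Σᵢ σ₁ m i · xⁱ.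
σ₁ : ℕ → ℕ → ℤ
σ₁ m i = sign (m ∸ i) ℤ.* + s₁ m i

σ₁-suc : ∀ m i → σ₁ (suc m) (suc i) ≡ σ₁ m i ℤ.- + m ℤ.* σ₁ m (suc i)
σ₁-suc m i with i ℕ.<? m
... | yes i<m rewrite sign-∸-suc i<m = begin
  ℤ.- s ℤ.* + (s₁ m i + m ℕ.* s₁ m (suc i))
    ≡⟨ cong (ℤ.- s ℤ.*_) (ℤ.pos-+ (s₁ m i) _) ⟩
  ℤ.- s ℤ.* (+ s₁ m i ℤ.+ + (m ℕ.* s₁ m (suc i)))
    ≡⟨ cong (λ x → ℤ.- s ℤ.* (+ s₁ m i ℤ.+ x)) (ℤ.pos-* m _) ⟩
  ℤ.- s ℤ.* (+ s₁ m i ℤ.+ + m ℤ.* + s₁ m (suc i))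
    ≡⟨ solve 4 (λ s a n b → (:- s) :* (a :+ n :* b) := (:- s) :* a :- n :* (s :* b)) refl
         s (+ s₁ m i) (+ m) (+ s₁ m (suc i)) ⟩
  ℤ.- s ℤ.* + s₁ m i ℤ.- + m ℤ.* (s ℤ.* + s₁ m (suc i)) ∎
  where s = sign (m ∸ suc i)
... | no i≮m rewrite i>m⇒s₁mi≡0 (s≤s (ℕ.≮⇒≥ i≮m)) | ℕ.*-zeroʳ m | ℕ.+-identityʳ (s₁ m i) =
  solve 3 (λ a n s → a := a :- n :* (s :* con (+ 0))) refl (σ₁ m i) (+ m) (sign (m ∸ suc i))

-- The umbral falling factorial: x(x-1)⋯(x-m+1) with each power xⁱ replaced by a i.
falling : ℕ → (ℕ → ℤ) → ℤ
falling m a = ΣZ (suc m) (λ i → σ₁ m i ℤ.* a i)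

falling-cong : ∀ m {a b : ℕ → ℤ} → (∀ i → a i ≡ b i) → falling m a ≡ falling m b
falling-cong m a≡b = ΣZ-cong (suc m) (λ i _ → cong (σ₁ m i ℤ.*_) (a≡b i))

falling-linear : ∀ m (a b : ℕ → ℤ) c →
  falling m (λ i → a i ℤ.+ c ℤ.* b i) ≡ falling m a ℤ.+ c ℤ.* falling m b
falling-linear m a b c = begin
  falling m (λ i → a i ℤ.+ c ℤ.* b i)
    ≡⟨ ΣZ-cong (suc m) (λ i _ → distribute (σ₁ m i) (a i) (b i)) ⟩
  ΣZ (suc m) (λ i → σ₁ m i ℤ.* a i ℤ.+ c ℤ.* (σ₁ m i ℤ.* b i))
    ≡⟨ ΣZ-distrib-+ (suc m) _ _ ⟩
  falling m a ℤ.+ ΣZ (suc m) (λ i → c ℤ.* (σ₁ m i ℤ.* b i))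
    ≡⟨ cong (λ x → falling m a ℤ.+ x) (*-distribˡ-ΣZ (suc m) c _) ⟨
  falling m a ℤ.+ c ℤ.* falling m b ∎
  where
  distribute : ∀ s x y → s ℤ.* (x ℤ.+ c ℤ.* y) ≡ s ℤ.* x ℤ.+ c ℤ.* (s ℤ.* y)
  distribute = solve 4 (λ c s x y → s :* (x :+ c :* y) := s :* x :+ c :* (s :* y)) refl c

-- The umbral form of x(x-1)⋯(x-m) = x · x(x-1)⋯(x-m+1) − m · x(x-1)⋯(x-m+1).
falling-suc : ∀ m a → falling (suc m) a ≡ falling m (a ∘ suc) ℤ.+ ℤ.- + m ℤ.* falling m a
falling-suc m a = begin
  falling (suc m) a
    ≡⟨ ΣZ-head (suc m) _ ⟩
  σ₁ (suc m) 0 ℤ.* a 0 ℤ.+ ΣZ (suc m) (λ i → σ₁ (suc m) (suc i) ℤ.* a (suc i))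
    ≡⟨ cong₂ ℤ._+_ σ₁[1+m,0]≡0 (ΣZ-cong (suc m) (λ i _ → split i)) ⟩
  + 0 ℤ.+ ΣZ (suc m) (λ i → g i ℤ.+ ℤ.- + m ℤ.* h (suc i))
    ≡⟨ ℤ.+-identityˡ _ ⟩
  ΣZ (suc m) (λ i → g i ℤ.+ ℤ.- + m ℤ.* h (suc i))
    ≡⟨ ΣZ-distrib-+ (suc m) g _ ⟩
  falling m (a ∘ suc) ℤ.+ ΣZ (suc m) (λ i → ℤ.- + m ℤ.* h (suc i))
    ≡⟨ cong (λ x → falling m (a ∘ suc) ℤ.+ x) (*-distribˡ-ΣZ (suc m) (ℤ.- + m) (h ∘ suc)) ⟨
  falling m (a ∘ suc) ℤ.+ ℤ.- + m ℤ.* ΣZ (suc m) (h ∘ suc)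
    ≡⟨ cong (λ x → falling m (a ∘ suc) ℤ.+ x) m*shifted ⟩
  falling m (a ∘ suc) ℤ.+ ℤ.- + m ℤ.* falling m a ∎
  where
  g h : ℕ → ℤ
  g i = σ₁ m i ℤ.* a (suc i)
  h i = σ₁ m i ℤ.* a i

  σ₁[1+m,0]≡0 : σ₁ (suc m) 0 ℤ.* a 0 ≡ + 0
  σ₁[1+m,0]≡0 rewrite ℤ.*-zeroʳ (sign (suc m)) = refl

  split : ∀ i → σ₁ (suc m) (suc i) ℤ.* a (suc i) ≡ g i ℤ.+ ℤ.- + m ℤ.* h (suc i)
  split i rewrite σ₁-suc m i =
    solve 4 (λ s t n x → (s :- n :* t) :* x := s :* x :+ (:- n) :* (t :* x)) refl
      (σ₁ m i) (σ₁ m (suc i)) (+ m) (a (suc i))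

  -- Shifting the index drops the term h 0 and adds h (1+m); the first is killed by the
  -- factor m (as s(m,0) = 0 unless m = 0), the second since s(m, 1+m) = 0.
  h[1+m]≡0 : h (suc m) ≡ + 0
  h[1+m]≡0 rewrite i>m⇒s₁mi≡0 {m} ℕ.≤-refl | ℤ.*-zeroʳ (sign (m ∸ suc m)) = refl

  m*h0≡0 : + m ℤ.* h 0 ≡ + 0
  m*h0≡0 = begin
    + m ℤ.* (sign m ℤ.* + s₁ m 0 ℤ.* a 0)
      ≡⟨ solve 4 (λ n s x y → n :* (s :* x :* y) := s :* (n :* x) :* y) refl
           (+ m) (sign m) (+ s₁ m 0) (a 0) ⟩
    sign m ℤ.* (+ m ℤ.* + s₁ m 0) ℤ.* a 0
      ≡⟨ cong (λ x → sign m ℤ.* x ℤ.* a 0)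
           (trans (sym (ℤ.pos-* m (s₁ m 0))) (cong +_ (m*s₁m0≡0 m))) ⟩
    sign m ℤ.* + 0 ℤ.* a 0
      ≡⟨ cong (ℤ._* a 0) (ℤ.*-zeroʳ (sign m)) ⟩
    + 0 ∎

  m*shifted : ℤ.- + m ℤ.* ΣZ (suc m) (h ∘ suc) ≡ ℤ.- + m ℤ.* falling m a
  m*shifted = begin
    ℤ.- + m ℤ.* ΣZ (suc m) (h ∘ suc)
      ≡⟨ solve 3 (λ n x y → :- n :* y := :- (n :* (x :+ y)) :+ n :* x) refl (+ m) (h 0) _ ⟩
    ℤ.- (+ m ℤ.* (h 0 ℤ.+ ΣZ (suc m) (h ∘ suc))) ℤ.+ + m ℤ.* h 0
      ≡⟨ cong₂ (λ x y → ℤ.- (+ m ℤ.* x) ℤ.+ y) (sym (ΣZ-head (suc m) h)) m*h0≡0 ⟩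
    ℤ.- (+ m ℤ.* (falling m a ℤ.+ h (suc m))) ℤ.+ + 0
      ≡⟨ cong (λ x → ℤ.- (+ m ℤ.* (falling m a ℤ.+ x)) ℤ.+ + 0) h[1+m]≡0 ⟩
    ℤ.- (+ m ℤ.* (falling m a ℤ.+ + 0)) ℤ.+ + 0
      ≡⟨ solve 2 (λ n y → :- (n :* (y :+ con (+ 0))) :+ con (+ 0) := :- n :* y) refl (+ m) _ ⟩
    ℤ.- + m ℤ.* falling m a ∎

falling-reverse : ∀ n a →
  ΣZ (suc n) (λ t → sign t ℤ.* + s₁ (suc n) (suc n ∸ t) ℤ.* a (suc n ∸ t)) ≡ falling (suc n) a
falling-reverse n a = begin
  ΣZ (suc n) (λ t → sign t ℤ.* + s₁ (suc n) (suc n ∸ t) ℤ.* a (suc n ∸ t))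
    ≡⟨ ΣZ-cong (suc n) reindex ⟩
  ΣZ (suc n) (λ t → f (suc n ∸ t))
    ≡⟨ ℤ.+-identityʳ _ ⟨
  ΣZ (suc n) (λ t → f (suc n ∸ t)) ℤ.+ + 0
    ≡⟨ cong (λ x → ΣZ (suc n) (λ t → f (suc n ∸ t)) ℤ.+ x) f0≡0 ⟨
  ΣZ (suc (suc n)) (λ t → f (suc n ∸ t))
    ≡⟨ ΣZ-reverse (suc n) f ⟨
  falling (suc n) a ∎
  where
  f : ℕ → ℤ
  f i = σ₁ (suc n) i ℤ.* a i

  reindex : ∀ t → t < suc n →
    sign t ℤ.* + s₁ (suc n) (suc n ∸ t) ℤ.* a (suc n ∸ t) ≡ f (suc n ∸ t)
  reindex t t<1+n =
    cong (λ i → sign i ℤ.* + s₁ (suc n) (suc n ∸ t) ℤ.* a (suc n ∸ t))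
      (sym (ℕ.m∸[m∸n]≡n (ℕ.<⇒≤ t<1+n)))

  f0≡0 : f (suc n ∸ suc n) ≡ + 0
  f0≡0 rewrite ℕ.n∸n≡0 n | ℤ.*-zeroʳ (sign (suc n)) = refl

binomial : (ℕ → ℤ) → ℕ → ℕ → ℤ
binomial h k m = ΣZ (suc m) (λ t → + (m C t) ℤ.* h (k + t))

binomial-suc : ∀ h k m → binomial h k (suc m) ≡ binomial h k m ℤ.+ binomial h (suc k) m
binomial-suc h k m = begin
  binomial h k (suc m)
    ≡⟨ ΣZ-head (suc m) _ ⟩
  g 0 ℤ.+ ΣZ (suc m) (λ t → + (suc m C suc t) ℤ.* h (k + suc t))
    ≡⟨ cong (λ x → g 0 ℤ.+ x) (ΣZ-cong (suc m) (λ t _ → pascal t)) ⟩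
  g 0 ℤ.+ ΣZ (suc m) (λ t → g (suc t) ℤ.+ + (m C t) ℤ.* h (suc k + t))
    ≡⟨ cong (λ x → g 0 ℤ.+ x) (ΣZ-distrib-+ (suc m) (g ∘ suc) _) ⟩
  g 0 ℤ.+ (ΣZ (suc m) (g ∘ suc) ℤ.+ binomial h (suc k) m)
    ≡⟨ ℤ.+-assoc (g 0) _ _ ⟨
  g 0 ℤ.+ ΣZ (suc m) (g ∘ suc) ℤ.+ binomial h (suc k) m
    ≡⟨ cong (ℤ._+ binomial h (suc k) m) (ΣZ-head (suc m) g) ⟨
  binomial h k m ℤ.+ g (suc m) ℤ.+ binomial h (suc k) m
    ≡⟨ cong (λ x → binomial h k m ℤ.+ x ℤ.+ binomial h (suc k) m) g[1+m]≡0 ⟩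
  binomial h k m ℤ.+ + 0 ℤ.+ binomial h (suc k) m
    ≡⟨ cong (ℤ._+ binomial h (suc k) m) (ℤ.+-identityʳ (binomial h k m)) ⟩
  binomial h k m ℤ.+ binomial h (suc k) m ∎
  where
  g : ℕ → ℤ
  g t = + (m C t) ℤ.* h (k + t)

  g[1+m]≡0 : g (suc m) ≡ + 0
  g[1+m]≡0 rewrite k>n⇒nCk≡0 {m} {suc m} ℕ.≤-refl = refl

  pascal : ∀ t → + (suc m C suc t) ℤ.* h (k + suc t) ≡ g (suc t) ℤ.+ + (m C t) ℤ.* h (suc k + t)
  pascal t rewrite sym (nCk+nC[k+1]≡[n+1]C[k+1] m t) | ℤ.pos-+ (m C t) (m C suc t) | ℕ.+-suc k t =
    solve 3 (λ x y z → (x :+ y) :* z := y :* z :+ x :* z) refl (+ (m C t)) (+ (m C suc t)) _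

module _ (j : ℕ) where

  fallingS₂ : ℕ → ℕ → ℤ
  fallingS₂ m K = falling m (λ i → + S₂ (j + i) K)

  fallingS₂-suc : ∀ m K → fallingS₂ (suc m) (suc K)
                        ≡ fallingS₂ m K ℤ.+ (+ suc K ℤ.- + m) ℤ.* fallingS₂ m (suc K)
  fallingS₂-suc m K = begin
    fallingS₂ (suc m) (suc K)
      ≡⟨ falling-suc m _ ⟩
    falling m (λ i → + S₂ (j + suc i) (suc K)) ℤ.+ ℤ.- + m ℤ.* F′
      ≡⟨ cong (ℤ._+ ℤ.- + m ℤ.* F′) (falling-cong m S₂-suc) ⟩
    falling m (λ i → + S₂ (j + i) K ℤ.+ + suc K ℤ.* + S₂ (j + i) (suc K)) ℤ.+ ℤ.- + m ℤ.* F′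
      ≡⟨ cong (ℤ._+ ℤ.- + m ℤ.* F′) (falling-linear m _ _ (+ suc K)) ⟩
    F ℤ.+ + suc K ℤ.* F′ ℤ.+ ℤ.- + m ℤ.* F′
      ≡⟨ solve 4 (λ x y k n → x :+ k :* y :+ (:- n) :* y := x :+ (k :- n) :* y) refl
           F F′ (+ suc K) (+ m) ⟩
    F ℤ.+ (+ suc K ℤ.- + m) ℤ.* F′ ∎
    where
    F F′ : ℤ
    F = fallingS₂ m K
    F′ = fallingS₂ m (suc K)

    S₂-suc : ∀ i → + S₂ (j + suc i) (suc K)
                   ≡ + S₂ (j + i) K ℤ.+ + suc K ℤ.* + S₂ (j + i) (suc K)
    S₂-suc i = begin
      + S₂ (j + suc i) (suc K)
        ≡⟨ cong (λ n → + S₂ n (suc K)) (ℕ.+-suc j i) ⟩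
      + (S₂ (j + i) K + suc K ℕ.* S₂ (j + i) (suc K))
        ≡⟨ ℤ.pos-+ (S₂ (j + i) K) _ ⟩
      + S₂ (j + i) K ℤ.+ + (suc K ℕ.* S₂ (j + i) (suc K))
        ≡⟨ cong (λ x → + S₂ (j + i) K ℤ.+ x) (ℤ.pos-* (suc K) _) ⟩
      + S₂ (j + i) K ℤ.+ + suc K ℤ.* + S₂ (j + i) (suc K) ∎

  factorial-S₂ : ℕ → ℤ
  factorial-S₂ n = + (n ! ℕ.* S₂ j n)

  binomial-S₂ : ∀ m k → binomial factorial-S₂ k m ≡ + (k !) ℤ.* fallingS₂ m (k + m)
  binomial-S₂ zero k rewrite ℕ.+-identityʳ k | ℕ.+-identityʳ j =
    trans (cong (λ x → + 0 ℤ.+ + 1 ℤ.* x) (ℤ.pos-* (k !) (S₂ j k)))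
      (solve 2 (λ f s → con (+ 0) :+ con (+ 1) :* (f :* s) := f :* (con (+ 0) :+ con (+ 1) :* s))
        refl (+ (k !)) (+ S₂ j k))
  binomial-S₂ (suc m) k = begin
    binomial factorial-S₂ k (suc m)
      ≡⟨ binomial-suc factorial-S₂ k m ⟩
    binomial factorial-S₂ k m ℤ.+ binomial factorial-S₂ (suc k) m
      ≡⟨ cong₂ ℤ._+_ (binomial-S₂ m k) (binomial-S₂ m (suc k)) ⟩
    + (k !) ℤ.* F ℤ.+ + (suc k ℕ.* k !) ℤ.* F′
      ≡⟨ cong (λ x → + (k !) ℤ.* F ℤ.+ x ℤ.* F′) (ℤ.pos-* (suc k) (k !)) ⟩
    + (k !) ℤ.* F ℤ.+ + suc k ℤ.* + (k !) ℤ.* F′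
      ≡⟨ solve 5 (λ f x y k n → f :* x :+ k :* f :* y := f :* (x :+ ((k :+ n) :- n) :* y)) refl
           (+ (k !)) F F′ (+ suc k) (+ m) ⟩
    + (k !) ℤ.* (F ℤ.+ (+ suc k ℤ.+ + m ℤ.- + m) ℤ.* F′)
      ≡⟨ cong (λ x → + (k !) ℤ.* (F ℤ.+ (x ℤ.- + m) ℤ.* F′)) (ℤ.pos-+ (suc k) m) ⟨
    + (k !) ℤ.* (F ℤ.+ (+ suc (k + m) ℤ.- + m) ℤ.* F′)
      ≡⟨ cong (+ (k !) ℤ.*_) (fallingS₂-suc m (k + m)) ⟨
    + (k !) ℤ.* fallingS₂ (suc m) (suc (k + m))
      ≡⟨ cong (λ K → + (k !) ℤ.* fallingS₂ (suc m) K) (ℕ.+-suc k m) ⟨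
    + (k !) ℤ.* fallingS₂ (suc m) (k + suc m) ∎
    where
    F F′ : ℤ
    F = fallingS₂ m (k + m)
    F′ = fallingS₂ m (suc (k + m))

lemma3 : (j k m : ℕ) → k ≤ j → .{{_ : NonZero m}} →
    ΣZ (m + 1) (λ t → + ((m C t) ℕ.* (k + t) ! ℕ.* S₂ j (k + t)))
      ≡ + (k !) ℤ.* ΣZ m (λ t → sign t ℤ.* + (s₁ m (m ∸ t) ℕ.* S₂ ((j + m) ∸ t) (k + m)))
lemma3 j k m@(suc n) _ = begin
  ΣZ (m + 1) summand
    ≡⟨ cong (λ l → ΣZ l summand) (ℕ.+-comm m 1) ⟩
  ΣZ (suc m) summand
    ≡⟨ ΣZ-cong (suc m) (λ t _ → trans (cong +_ (ℕ.*-assoc (m C t) _ _)) (ℤ.pos-* (m C t) _)) ⟩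
  binomial (factorial-S₂ j) k m
    ≡⟨ binomial-S₂ j m k ⟩
  + (k !) ℤ.* fallingS₂ j m (k + m)
    ≡⟨ cong (+ (k !) ℤ.*_) (falling-reverse n _) ⟨
  + (k !) ℤ.* ΣZ m (λ t → sign t ℤ.* + s₁ m (m ∸ t) ℤ.* + S₂ (j + (m ∸ t)) (k + m))
    ≡⟨ cong (+ (k !) ℤ.*_) (ΣZ-cong m (λ t t<m → regroup t (ℕ.<⇒≤ t<m))) ⟩
  + (k !) ℤ.* ΣZ m (λ t → sign t ℤ.* + (s₁ m (m ∸ t) ℕ.* S₂ ((j + m) ∸ t) (k + m))) ∎
  where
  summand : ℕ → ℤ
  summand t = + ((m C t) ℕ.* (k + t) ! ℕ.* S₂ j (k + t))

  regroup : ∀ t → t ≤ m → sign t ℤ.* + s₁ m (m ∸ t) ℤ.* + S₂ (j + (m ∸ t)) (k + m)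
                          ≡ sign t ℤ.* + (s₁ m (m ∸ t) ℕ.* S₂ ((j + m) ∸ t) (k + m))
  regroup t t≤m rewrite ℕ.+-∸-assoc j t≤m =
    trans (ℤ.*-assoc (sign t) _ _) (cong (sign t ℤ.*_) (sym (ℤ.pos-* (s₁ m (m ∸ t)) _)))
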